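{- The numbers $b_{n,m,k}$ satisfy $$b_{n,m,k}=(m-k+1)\,b_{n,m,k-1}+b_{n,m-1,k}+b_{n-1,m,k}$$ for all $n\geq 2$ and $0\leq k\leq m\leq n$. Here the conventions $b_{m-1,m,k}=0$, $b_{n,k-1,k}=0$ and $b_{n,m,-1}=0$ are used. Together with the initial values $b_{0,0,0}=b_{1,0,0}=b_{1,1,0}=b_{1,1,1}=1$, this recurrence uniquely determines all $b_{n,m,k}$.
   Context: Rows are numbered from bottom (row 1) to top (row 3). For $n\geq m\geq k\geq 0$ and a $k$-subset $S\subseteq\{1,\dots,m\}$, take the cells $(1,j)$ for $j\leq n$, $(2,j)$ for $j\leq m$, and $(3,j)$ for $j\in S$. Count bijective fillings $T$ with $\{1,\dots,n+m+k\}$ such that: - rows 1 and 2 increase left to right; - $T(1,j)<T(2,j)$ for $j\leq m$, and $T(2,j)<T(3,j)$ for $j\in S$. The top row carries no row condition (walls). $b_{n,m,k}$ is the sum of these counts over all $k$-subsets $S$. -}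

module Defs where

open import Data.Nat using (ℕ; zero; suc; _+_; _*_; _∸_; _<ᵇ_; _≤ᵇ_; _≡ᵇ_; _≤_)
open import Data.Bool using (Bool; true; false; _∧_; if_then_else_)
open import Data.List using (List; []; _∷_; map; concatMap; length; filterᵇ; take; drop; upTo)
open import Data.Nat.ListAction using (sum)
open import Data.Product using (_×_)
open import Relation.Binary.PropositionalEquality using (_≡_)

insertions : {A : Set} → A → List A → List (List A)
insertions x [] = (x ∷ []) ∷ []
insertions x (y ∷ ys) = (x ∷ y ∷ ys) ∷ map (y ∷_) (insertions x ys)

perms : {A : Set} → List A → List (List A)
perms [] = [] ∷ []
perms (x ∷ xs) = concatMap (insertions x) (perms xs)

-- all subsets of {1,…,m}, as characteristic lists of length m
subsets : ℕ → List (List Bool)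
subsets zero = [] ∷ []
subsets (suc m) = concatMap (λ s → (true ∷ s) ∷ (false ∷ s) ∷ []) (subsets m)

card : List Bool → ℕ
card [] = 0
card (true ∷ s) = suc (card s)
card (false ∷ s) = card s

increasing : List ℕ → Bool
increasing (x ∷ y ∷ ys) = (x <ᵇ y) ∧ increasing (y ∷ ys)
increasing _ = true

columns12 : List ℕ → List ℕ → Bool
columns12 (x ∷ r1) (y ∷ r2) = (x <ᵇ y) ∧ columns12 r1 r2
columns12 _ _ = true

-- T(2,j) < T(3,j) for j ∈ S; row 3 entries are listed left to right
-- (in increasing order of the columns j ∈ S)
columns23 : List Bool → List ℕ → List ℕ → Bool
columns23 [] _ _ = true
columns23 (false ∷ s) (x ∷ r2) r3 = columns23 s r2 r3
columns23 (true ∷ s) (x ∷ r2) (z ∷ r3) = (x <ᵇ z) ∧ columns23 s r2 r3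
columns23 _ _ _ = false

-- A filling of the shape (n, m, S) is read off from an ordering p of
-- {1,…,n+m+k}: the first n entries form row 1 (columns 1..n), the next m
-- entries form row 2 (columns 1..m), the remaining k entries fill the
-- cells (3,j), j ∈ S, from left to right.  This is a bijection between
-- orderings and bijective fillings.
validFilling : ℕ → ℕ → List Bool → List ℕ → Bool
validFilling n m S p =
  increasing r1 ∧ increasing r2 ∧ columns12 r1 r2 ∧ columns23 S r2 r3
  where
    r1 = take n p
    r2 = take m (drop n p)
    r3 = drop (n + m) p

fillings : ℕ → ℕ → List Bool → ℕ
fillings n m S =
  length (filterᵇ (validFilling n m S) (perms (map suc (upTo (n + m + card S)))))

-- b_{n,m,k}: sum over k-subsets S ⊆ {1..m}; defined as 0 when m > n
-- (the shape only makes sense for n ≥ m), which is the paper's convention.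
b : ℕ → ℕ → ℕ → ℕ
b n m k =
  if m ≤ᵇ n
  then sum (map (fillings n m) (filterᵇ (λ S → card S ≡ᵇ k) (subsets m)))
  else 0

-- the three terms of the recurrence, with the conventions
-- b_{n,m,-1} = 0, b_{n,k-1,k} = 0, b_{m-1,m,k} = 0 made explicit
termK : (ℕ → ℕ → ℕ → ℕ) → ℕ → ℕ → ℕ → ℕ
termK f n m zero = 0
termK f n m (suc k) = f n m k

termM : (ℕ → ℕ → ℕ → ℕ) → ℕ → ℕ → ℕ → ℕ
termM f n zero k = 0
termM f n (suc m) k = if k ≤ᵇ m then f n m k else 0

termN : (ℕ → ℕ → ℕ → ℕ) → ℕ → ℕ → ℕ → ℕ
termN f n m k = if m ≤ᵇ (n ∸ 1) then f (n ∸ 1) m k else 0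

Recurrence : (ℕ → ℕ → ℕ → ℕ) → Set
Recurrence f = ∀ n m k → 2 ≤ n → k ≤ m → m ≤ n →
  f n m k ≡ (m ∸ k + 1) * termK f n m k + termM f n m k + termN f n m k

InitialValues : (ℕ → ℕ → ℕ → ℕ) → Set
InitialValues f = (f 0 0 0 ≡ 1) × (f 1 0 0 ≡ 1) × (f 1 1 0 ≡ 1) × (f 1 1 1 ≡ 1)

-- Read a filling as its reading word (row 1, row 2, then row 3 from left to right), so that a filling
-- with largest entry N arises by inserting N into a word on the labels below N.  As rows 1 and 2
-- increase, N is the last entry of row 1, the last entry of row 2, or any entry of row 3.  The last
-- cell (1, n) of row 1 can hold N iff m ≤ n - 1, and removing it leaves shape (n - 1, m, S); the last
-- cell (2, m) can hold N iff m ∉ S, leaving shape (n, m - 1, S); every cell (3, j) with j ∈ S can hold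
-- N, leaving shape (n, m, S ∖ {j}).  Summed over k-subsets S, the last case counts every (k - 1)-subset
-- once for each of its m - k + 1 missing columns.  Uniqueness is an induction on n and, within a
-- fixed n, lexicographically on (m, k).

module Submission where

open import Defs
open import Data.Nat using (ℕ; zero; suc; _+_; _*_; _∸_; _<ᵇ_; _≤ᵇ_; _≡ᵇ_; _≤_; _<_; z≤n; s≤s; _<?_)
open import Data.Nat.Properties
open import Data.Nat.Tactic.RingSolver using (solve-∀)
open import Data.Nat.ListAction using (sum)
open import Data.Bool using (Bool; true; false; _∧_; not; if_then_else_; T)
open import Data.Unit using (tt)
open import Data.Bool.Properties using (∧-zeroʳ; T-≡)
open import Function.Bundles using (Equivalence)
open import Data.List using (List; []; _∷_; map; concatMap; length; filterᵇ; take; drop; upTo; _++_)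
open import Data.List.Properties using (map-++; length-map; length-++; length-upTo; upTo-∷ʳ; drop-drop)
open import Data.List.Relation.Unary.All using (All; []; _∷_)
import Data.List.Relation.Unary.All as All
open import Data.List.Relation.Unary.All.Properties using (map⁺; ++⁺)
open import Data.Product using (_×_; _,_)
open import Relation.Nullary using (yes; no)
open import Relation.Binary.PropositionalEquality
open import Function using (_∘_)

private variable A B : Set

∑ : List A → (A → ℕ) → ℕ
∑ [] g = 0
∑ (a ∷ L) g = g a + ∑ L g

∑< : ℕ → (ℕ → ℕ) → ℕ
∑< zero h = 0
∑< (suc n) h = h 0 + ∑< n (h ∘ suc)

syntax ∑ L (λ a → g) = ∑[ a ∈ L ] g
syntax ∑< n (λ j → h) = ∑[ j < n ] h

onlyIf : Bool → ℕ → ℕ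
onlyIf c v = if c then v else 0

𝟙 : Bool → ℕ
𝟙 c = onlyIf c 1

onlyIf-+ : ∀ c u v → onlyIf c (u + v) ≡ onlyIf c u + onlyIf c v
onlyIf-+ true u v = refl
onlyIf-+ false u v = refl

onlyIf-0 : ∀ c → onlyIf c 0 ≡ 0
onlyIf-0 true = refl
onlyIf-0 false = refl

𝟙-∧ : ∀ c v → 𝟙 (c ∧ v) ≡ onlyIf c (𝟙 v)
𝟙-∧ true v = refl
𝟙-∧ false v = refl

onlyIf-cong : ∀ c {u v} → (T c → u ≡ v) → onlyIf c u ≡ onlyIf c v
onlyIf-cong true e = e tt
onlyIf-cong false e = refl

sum-map : (L : List A) (g : A → ℕ) → sum (map g L) ≡ ∑ L g
sum-map [] g = refl
sum-map (a ∷ L) g = cong (g a +_) (sum-map L g)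

∑-++ : (L M : List A) (g : A → ℕ) → ∑ (L ++ M) g ≡ ∑ L g + ∑ M g
∑-++ [] M g = refl
∑-++ (a ∷ L) M g = trans (cong (g a +_) (∑-++ L M g)) (sym (+-assoc (g a) _ _))

∑-map : (h : A → B) (L : List A) (g : B → ℕ) → ∑ (map h L) g ≡ ∑ L (g ∘ h)
∑-map h [] g = refl
∑-map h (a ∷ L) g = cong (g (h a) +_) (∑-map h L g)

∑-concatMap : (f : A → List B) (L : List A) (g : B → ℕ) →
  ∑ (concatMap f L) g ≡ ∑[ a ∈ L ] (∑ (f a) g)
∑-concatMap f [] g = refl
∑-concatMap f (a ∷ L) g = trans (∑-++ (f a) (concatMap f L) g) (cong (∑ (f a) g +_) (∑-concatMap f L g))

∑-congᴬ : {P : A → Set} (L : List A) {g h : A → ℕ} → All P L → (∀ a → P a → g a ≡ h a) → ∑ L g ≡ ∑ L h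
∑-congᴬ [] _ e = refl
∑-congᴬ (a ∷ L) (pa ∷ ps) e = cong₂ _+_ (e a pa) (∑-congᴬ L ps e)

∑-cong : (L : List A) {g h : A → ℕ} → (∀ a → g a ≡ h a) → ∑ L g ≡ ∑ L h
∑-cong [] e = refl
∑-cong (a ∷ L) e = cong₂ _+_ (e a) (∑-cong L e)

∑-+ : (L : List A) (g h : A → ℕ) → ∑[ a ∈ L ] (g a + h a) ≡ ∑ L g + ∑ L h
∑-+ [] g h = refl
∑-+ (a ∷ L) g h = trans (cong (g a + h a +_) (∑-+ L g h)) (interchange (g a) (h a) (∑ L g) (∑ L h))
  where
  interchange : ∀ a b c d → a + b + (c + d) ≡ a + c + (b + d)
  interchange = solve-∀

∑-0 : (L : List A) → ∑[ a ∈ L ] 0 ≡ 0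
∑-0 [] = refl
∑-0 (a ∷ L) = ∑-0 L

∑-onlyIf : (L : List A) (c : Bool) (g : A → ℕ) → ∑[ a ∈ L ] onlyIf c (g a) ≡ onlyIf c (∑ L g)
∑-onlyIf L true g = refl
∑-onlyIf L false g = ∑-0 L

∑-filterᵇ : (P : A → Bool) (L : List A) (g : A → ℕ) → ∑ (filterᵇ P L) g ≡ ∑[ a ∈ L ] onlyIf (P a) (g a)
∑-filterᵇ P [] g = refl
∑-filterᵇ P (a ∷ L) g with P a
... | true = cong (g a +_) (∑-filterᵇ P L g)
... | false = ∑-filterᵇ P L g

length-filterᵇ : (P : A → Bool) (L : List A) → length (filterᵇ P L) ≡ ∑[ a ∈ L ] 𝟙 (P a)
length-filterᵇ P [] = refl
length-filterᵇ P (a ∷ L) with P a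
... | true = cong suc (length-filterᵇ P L)
... | false = length-filterᵇ P L

∑<-cong : ∀ n {g h : ℕ → ℕ} → (∀ j → j < n → g j ≡ h j) → ∑< n g ≡ ∑< n h
∑<-cong zero e = refl
∑<-cong (suc n) e = cong₂ _+_ (e 0 (s≤s z≤n)) (∑<-cong n (λ j lt → e (suc j) (s≤s lt)))

∑<-0 : ∀ n → ∑[ j < n ] 0 ≡ 0
∑<-0 zero = refl
∑<-0 (suc n) = ∑<-0 n

∑<-+ : ∀ a c h → ∑< (a + c) h ≡ ∑< a h + ∑[ j < c ] h (a + j)
∑<-+ zero c h = refl
∑<-+ (suc a) c h = trans (cong (h 0 +_) (∑<-+ a c (h ∘ suc))) (sym (+-assoc (h 0) _ _))

∑<-suc : ∀ a h → ∑< (suc a) h ≡ ∑< a h + h a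
∑<-suc a h = trans (cong (λ z → ∑< z h) (+-comm 1 a))
  (trans (∑<-+ a 1 h) (cong (∑< a h +_) (trans (+-identityʳ _) (cong h (+-identityʳ a)))))

∑-∑<-comm : (L : List A) (n : ℕ) (g : A → ℕ → ℕ) → ∑[ a ∈ L ] ∑< n (g a) ≡ ∑[ j < n ] ∑[ a ∈ L ] g a j
∑-∑<-comm L zero g = ∑-0 L
∑-∑<-comm L (suc n) g = trans (∑-+ L (λ a → g a 0) (λ a → ∑< n (g a ∘ suc)))
  (cong (∑[ a ∈ L ] g a 0 +_) (∑-∑<-comm L n (λ a → g a ∘ suc)))

-- Permutations as iterated insertions

∑-insertions-comm : (x y : A) (q : List A) (g : List A → ℕ) →
  ∑[ r ∈ insertions x q ] ∑ (insertions y r) g ≡ ∑[ r ∈ insertions y q ] ∑ (insertions x r) g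
∑-insertions-comm x y [] g = swap (g (y ∷ x ∷ [])) (g (x ∷ y ∷ []))
  where
  swap : ∀ a b → a + (b + 0) + 0 ≡ b + (a + 0) + 0
  swap = solve-∀
∑-insertions-comm x y (z ∷ w) g = begin
  ∑[ r ∈ insertions x (z ∷ w) ] ∑ (insertions y r) g
    ≡⟨ cong₂ _+_ (front x y) (behind x y) ⟩
  g (y ∷ x ∷ z ∷ w) + (g (x ∷ y ∷ z ∷ w) + Y) + (X + ∑[ r ∈ insertions x w ] ∑ (insertions y r) (g ∘ (z ∷_)))
    ≡⟨ cong (λ e → g (y ∷ x ∷ z ∷ w) + (g (x ∷ y ∷ z ∷ w) + Y) + (X + e)) (∑-insertions-comm x y w (g ∘ (z ∷_))) ⟩
  g (y ∷ x ∷ z ∷ w) + (g (x ∷ y ∷ z ∷ w) + Y) + (X + ∑[ r ∈ insertions y w ] ∑ (insertions x r) (g ∘ (z ∷_)))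
    ≡⟨ regroup (g (y ∷ x ∷ z ∷ w)) (g (x ∷ y ∷ z ∷ w)) Y X _ ⟩
  g (x ∷ y ∷ z ∷ w) + (g (y ∷ x ∷ z ∷ w) + X) + (Y + ∑[ r ∈ insertions y w ] ∑ (insertions x r) (g ∘ (z ∷_)))
    ≡⟨ cong₂ _+_ (front y x) (behind y x) ⟨
  ∑[ r ∈ insertions y (z ∷ w) ] ∑ (insertions x r) g ∎
  where
  open ≡-Reasoning
  X = ∑[ r ∈ insertions x w ] g (y ∷ z ∷ r)
  Y = ∑[ s ∈ insertions y w ] g (x ∷ z ∷ s)
  regroup : ∀ a b c d e → a + (b + c) + (d + e) ≡ b + (a + d) + (c + e)
  regroup = solve-∀
  front : (x y : _) → ∑ (insertions y (x ∷ z ∷ w)) g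
    ≡ g (y ∷ x ∷ z ∷ w) + (g (x ∷ y ∷ z ∷ w) + ∑[ s ∈ insertions y w ] g (x ∷ z ∷ s))
  front x y = cong (g (y ∷ x ∷ z ∷ w) +_) (trans (∑-map (x ∷_) (insertions y (z ∷ w)) g)
                (cong (g (x ∷ y ∷ z ∷ w) +_) (∑-map (z ∷_) (insertions y w) (g ∘ (x ∷_)))))
  behind : (x y : _) → ∑[ r ∈ map (z ∷_) (insertions x w) ] ∑ (insertions y r) g
    ≡ ∑[ r ∈ insertions x w ] g (y ∷ z ∷ r) + ∑[ r ∈ insertions x w ] ∑ (insertions y r) (g ∘ (z ∷_))
  behind x y = trans (∑-map (z ∷_) (insertions x w) _)
    (trans (∑-cong (insertions x w) (λ r → cong (g (y ∷ z ∷ r) +_) (∑-map (z ∷_) (insertions y r) g)))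
      (∑-+ (insertions x w) _ _))

∑-perms-∷ʳ : (xs : List A) (x : A) (g : List A → ℕ) →
  ∑ (perms (xs ++ x ∷ [])) g ≡ ∑[ q ∈ perms xs ] ∑ (insertions x q) g
∑-perms-∷ʳ [] x g = sym (+-identityʳ _)
∑-perms-∷ʳ (y ∷ xs) x g = begin
  ∑[ p ∈ concatMap (insertions y) (perms (xs ++ x ∷ [])) ] g p
    ≡⟨ ∑-concatMap (insertions y) (perms (xs ++ x ∷ [])) g ⟩
  ∑[ r ∈ perms (xs ++ x ∷ []) ] ∑ (insertions y r) g
    ≡⟨ ∑-perms-∷ʳ xs x (λ r → ∑ (insertions y r) g) ⟩
  ∑[ q ∈ perms xs ] ∑[ r ∈ insertions x q ] ∑ (insertions y r) g
    ≡⟨ ∑-cong (perms xs) (λ q → ∑-insertions-comm x y q g) ⟩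
  ∑[ q ∈ perms xs ] ∑[ r ∈ insertions y q ] ∑ (insertions x r) g
    ≡⟨ ∑-concatMap (insertions y) (perms xs) (λ r → ∑ (insertions x r) g) ⟨
  ∑[ r ∈ concatMap (insertions y) (perms xs) ] ∑ (insertions x r) g ∎
  where open ≡-Reasoning

All-concatMap : {P : B → Set} (f : A → List B) (L : List A) → All (λ a → All P (f a)) L → All P (concatMap f L)
All-concatMap f [] [] = []
All-concatMap f (a ∷ L) (p ∷ ps) = ++⁺ p (All-concatMap f L ps)

All-insertions : {P : A → Set} (x : A) (q : List A) → P x → All P q →
  All (λ p → All P p × length p ≡ suc (length q)) (insertions x q)
All-insertions x [] px [] = (px ∷ [] , refl) ∷ []
All-insertions x (y ∷ q) px (py ∷ aq) = (px ∷ py ∷ aq , refl) ∷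
  map⁺ (All.map (λ { (a , l) → (py ∷ a) , cong suc l }) (All-insertions x q px aq))

All-perms : {P : A → Set} (xs : List A) → All P xs → All (λ p → All P p × length p ≡ length xs) (perms xs)
All-perms [] [] = ([] , refl) ∷ []
All-perms (x ∷ xs) (px ∷ ap) = All-concatMap (insertions x) (perms xs)
  (All.map (λ { {q} (aq , lq) → All.map (λ { (a , l) → a , trans l (cong suc lq) }) (All-insertions x q px aq) })
           (All-perms xs ap))

insertAt : ℕ → A → List A → List A
insertAt zero x q = x ∷ q
insertAt (suc j) x [] = x ∷ []
insertAt (suc j) x (y ∷ q) = y ∷ insertAt j x q

∑-insertions : (x : A) (q : List A) (g : List A → ℕ) →
  ∑ (insertions x q) g ≡ ∑[ j < suc (length q) ] g (insertAt j x q)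
∑-insertions x [] g = refl
∑-insertions x (y ∷ q) g =
  cong (g (x ∷ y ∷ q) +_) (trans (∑-map (y ∷_) (insertions x q) g) (∑-insertions x q (g ∘ (y ∷_))))

length-insertAt : (j : ℕ) (x : A) (q : List A) → length (insertAt j x q) ≡ suc (length q)
length-insertAt zero x q = refl
length-insertAt (suc j) x [] = refl
length-insertAt (suc j) x (y ∷ q) = cong suc (length-insertAt j x q)

insertAt-++ˡ : (j : ℕ) (x : A) (P Q : List A) → j ≤ length P → insertAt j x (P ++ Q) ≡ insertAt j x P ++ Q
insertAt-++ˡ zero x P Q _ = refl
insertAt-++ˡ (suc j) x (y ∷ P) Q (s≤s le) = cong (y ∷_) (insertAt-++ˡ j x P Q le)

insertAt-++ʳ : (j : ℕ) (x : A) (P Q : List A) → insertAt (length P + j) x (P ++ Q) ≡ P ++ insertAt j x Q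
insertAt-++ʳ j x [] Q = refl
insertAt-++ʳ j x (y ∷ P) Q = cong (y ∷_) (insertAt-++ʳ j x P Q)

insertAt-length : (x : A) (P : List A) → insertAt (length P) x P ≡ P ++ x ∷ []
insertAt-length x [] = refl
insertAt-length x (y ∷ P) = cong (y ∷_) (insertAt-length x P)

take-length-++ : (P Q : List A) → take (length P) (P ++ Q) ≡ P
take-length-++ [] Q = refl
take-length-++ (y ∷ P) Q = cong (y ∷_) (take-length-++ P Q)

drop-length-++ : (P Q : List A) → drop (length P) (P ++ Q) ≡ Q
drop-length-++ [] Q = refl
drop-length-++ (y ∷ P) Q = drop-length-++ P Q

-- Reading words of fillings

labels : ℕ → List ℕ
labels L = map suc (upTo L)

labels-suc : ∀ L → labels (suc L) ≡ labels L ++ suc L ∷ []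
labels-suc L = trans (cong (map suc) (sym (upTo-∷ʳ L))) (map-++ suc (upTo L) (L ∷ []))

length-labels : ∀ L → length (labels L) ≡ L
length-labels L = trans (length-map suc (upTo L)) (length-upTo L)

All-labels-< : ∀ L → All (_< suc L) (labels L)
All-labels-< zero = []
All-labels-< (suc L) = subst (All (_< suc (suc L))) (sym (labels-suc L))
  (++⁺ (All.map m<n⇒m<1+n (All-labels-< L)) (n<1+n (suc L) ∷ []))

<ᵇ-true : ∀ {a x} → a < x → (a <ᵇ x) ≡ true
<ᵇ-true lt = Equivalence.to T-≡ (<⇒<ᵇ lt)

<ᵇ-false : ∀ a x → a < x → (x <ᵇ a) ≡ false
<ᵇ-false zero (suc x) _ = refl
<ᵇ-false (suc a) (suc x) (s≤s lt) = <ᵇ-false a x lt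

increasing-∷ʳ : ∀ x (P : List ℕ) → All (_< x) P → increasing (P ++ x ∷ []) ≡ increasing P
increasing-∷ʳ x [] _ = refl
increasing-∷ʳ x (a ∷ []) (pa ∷ _) rewrite <ᵇ-true pa = refl
increasing-∷ʳ x (a ∷ a' ∷ P) (pa ∷ ps) = cong ((a <ᵇ a') ∧_) (increasing-∷ʳ x (a' ∷ P) ps)

increasing-∷-false : ∀ a (L : List ℕ) → increasing L ≡ false → increasing (a ∷ L) ≡ false
increasing-∷-false a (y ∷ L) e rewrite e = ∧-zeroʳ (a <ᵇ y)

increasing-insertAt-max : ∀ x j (P : List ℕ) → All (_< x) P → j < length P → increasing (insertAt j x P) ≡ false
increasing-insertAt-max x zero (a ∷ P) (pa ∷ _) _ rewrite <ᵇ-false a x pa = refl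
increasing-insertAt-max x (suc j) (a ∷ P) (_ ∷ ps) (s≤s lt) =
  increasing-∷-false a (insertAt j x P) (increasing-insertAt-max x j P ps lt)

columns12-∷ʳˡ : ∀ x (P B : List ℕ) → length B ≤ length P → columns12 (P ++ x ∷ []) B ≡ columns12 P B
columns12-∷ʳˡ x [] [] _ = refl
columns12-∷ʳˡ x (a ∷ P) [] _ = refl
columns12-∷ʳˡ x (a ∷ P) (b ∷ B) (s≤s le) = cong ((a <ᵇ b) ∧_) (columns12-∷ʳˡ x P B le)

columns12-∷ʳˡ-max : ∀ x (P B : List ℕ) → All (_< x) B → length P < length B → columns12 (P ++ x ∷ []) B ≡ false
columns12-∷ʳˡ-max x [] (b ∷ B) (pb ∷ _) _ rewrite <ᵇ-false b x pb = refl
columns12-∷ʳˡ-max x (a ∷ P) (b ∷ B) (_ ∷ ps) (s≤s lt) rewrite columns12-∷ʳˡ-max x P B ps lt = ∧-zeroʳ (a <ᵇ b)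

columns12-[] : (P : List ℕ) → columns12 P [] ≡ true
columns12-[] [] = refl
columns12-[] (a ∷ P) = refl

columns12-∷ʳʳ : ∀ x (P B : List ℕ) → All (_< x) P → columns12 P (B ++ x ∷ []) ≡ columns12 P B
columns12-∷ʳʳ x [] B _ = refl
columns12-∷ʳʳ x (a ∷ P) [] (pa ∷ _) rewrite <ᵇ-true pa = columns12-[] P
columns12-∷ʳʳ x (a ∷ P) (b ∷ B) (_ ∷ ps) = cong ((a <ᵇ b) ∧_) (columns12-∷ʳʳ x P B ps)

columns23-∷ʳ-false : ∀ x (S : List Bool) (B C : List ℕ) → length S ≡ length B →
  columns23 (S ++ false ∷ []) (B ++ x ∷ []) C ≡ columns23 S B C
columns23-∷ʳ-false x [] [] C _ = refl
columns23-∷ʳ-false x (false ∷ S) (b ∷ B) C e = columns23-∷ʳ-false x S B C (suc-injective e)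
columns23-∷ʳ-false x (true ∷ S) (b ∷ B) [] e = refl
columns23-∷ʳ-false x (true ∷ S) (b ∷ B) (c ∷ C) e = cong ((b <ᵇ c) ∧_) (columns23-∷ʳ-false x S B C (suc-injective e))

columns23-∷ʳ-true-max : ∀ x (S : List Bool) (B C : List ℕ) → All (_< x) C → length S ≡ length B →
  columns23 (S ++ true ∷ []) (B ++ x ∷ []) C ≡ false
columns23-∷ʳ-true-max x [] [] [] _ _ = refl
columns23-∷ʳ-true-max x [] [] (c ∷ C) (pc ∷ _) _ rewrite <ᵇ-false c x pc = refl
columns23-∷ʳ-true-max x (false ∷ S) (b ∷ B) C pc e = columns23-∷ʳ-true-max x S B C pc (suc-injective e)
columns23-∷ʳ-true-max x (true ∷ S) (b ∷ B) [] _ e = refl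
columns23-∷ʳ-true-max x (true ∷ S) (b ∷ B) (c ∷ C) (_ ∷ pc) e
  rewrite columns23-∷ʳ-true-max x S B C pc (suc-injective e) = ∧-zeroʳ (b <ᵇ c)

-- The subset S with its t-th element (counting from 0) removed; the characteristic list keeps its length.
removeNth : ℕ → List Bool → List Bool
removeNth t [] = []
removeNth t (false ∷ S) = false ∷ removeNth t S
removeNth zero (true ∷ S) = false ∷ S
removeNth (suc t) (true ∷ S) = true ∷ removeNth t S

card-removeNth : ∀ t S → t < card S → suc (card (removeNth t S)) ≡ card S
card-removeNth t (false ∷ S) lt = card-removeNth t S lt
card-removeNth zero (true ∷ S) lt = refl
card-removeNth (suc t) (true ∷ S) (s≤s lt) = cong suc (card-removeNth t S lt)

card-∷ʳ-false : ∀ S → card (S ++ false ∷ []) ≡ card S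
card-∷ʳ-false [] = refl
card-∷ʳ-false (false ∷ S) = card-∷ʳ-false S
card-∷ʳ-false (true ∷ S) = cong suc (card-∷ʳ-false S)

columns23-[] : ∀ S (B : List ℕ) → 0 < card S → columns23 S B [] ≡ false
columns23-[] (false ∷ S) [] lt = refl
columns23-[] (false ∷ S) (b ∷ B) lt = columns23-[] S B lt
columns23-[] (true ∷ S) [] lt = refl
columns23-[] (true ∷ S) (b ∷ B) lt = refl

columns23-insertAt-max : ∀ x t S (B C : List ℕ) → All (_< x) B → t < card S →
  columns23 S B (insertAt t x C) ≡ columns23 (removeNth t S) B C
columns23-insertAt-max x t (false ∷ S) [] C _ lt = refl
columns23-insertAt-max x t (false ∷ S) (b ∷ B) C (_ ∷ pb) lt = columns23-insertAt-max x t S B C pb lt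
columns23-insertAt-max x zero (true ∷ S) [] C _ lt = refl
columns23-insertAt-max x (suc t) (true ∷ S) [] C _ lt = refl
columns23-insertAt-max x zero (true ∷ S) (b ∷ B) C (pb ∷ _) lt rewrite <ᵇ-true pb = refl
columns23-insertAt-max x (suc t) (true ∷ S) (b ∷ B) [] (pb ∷ _) (s≤s lt)
  rewrite <ᵇ-true pb = columns23-[] S B (≤-trans (s≤s z≤n) lt)
columns23-insertAt-max x (suc t) (true ∷ S) (b ∷ B) (c ∷ C) (_ ∷ ps) (s≤s lt) =
  cong ((b <ᵇ c) ∧_) (columns23-insertAt-max x t S B C ps lt)

validRows : List Bool → List ℕ → List ℕ → List ℕ → Bool
validRows S A B C = increasing A ∧ (increasing B ∧ (columns12 A B ∧ columns23 S B C))

validRows-row₁-increasing : ∀ S (A B C : List ℕ) → increasing A ≡ false → validRows S A B C ≡ false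
validRows-row₁-increasing S A B C e rewrite e = refl

validRows-row₂-increasing : ∀ S (A B C : List ℕ) → increasing B ≡ false → validRows S A B C ≡ false
validRows-row₂-increasing S A B C e rewrite e = ∧-zeroʳ (increasing A)

validFilling-++ : ∀ {n m} S (A B C : List ℕ) → length A ≡ n → length B ≡ m →
  validFilling n m S (A ++ B ++ C) ≡ validRows S A B C
validFilling-++ S A B C refl refl = begin
  validFilling (length A) (length B) S (A ++ B ++ C)
    ≡⟨ cong (λ r₃ → check (take (length A) p) (take (length B) (drop (length A) p)) r₃)
            (sym (drop-drop (length A) (length B) p)) ⟩
  check (take (length A) p) (take (length B) (drop (length A) p)) (drop (length B) (drop (length A) p))
    ≡⟨ cong₂ (λ r₁ rest → check r₁ (take (length B) rest) (drop (length B) rest))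
             (take-length-++ A (B ++ C)) (drop-length-++ A (B ++ C)) ⟩
  check A (take (length B) (B ++ C)) (drop (length B) (B ++ C))
    ≡⟨ cong₂ (check A) (take-length-++ B C) (drop-length-++ B C) ⟩
  validRows S A B C ∎
  where
  open ≡-Reasoning
  p = A ++ B ++ C
  check = validRows S

data Split (P : ℕ → Set) : ℕ → List ℕ → Set where
  split : (A R : List ℕ) → All P A → All P R → Split P (length A) (A ++ R)

splitAt : {P : ℕ → Set} (a : ℕ) (q : List ℕ) → a ≤ length q → All P q → Split P a q
splitAt zero q _ pq = split [] q [] pq
splitAt (suc a) (y ∷ q) (s≤s le) (py ∷ pq) with splitAt a q le pq
... | split A R pA pR = split (y ∷ A) R (py ∷ pA) pR

data Rows (P : ℕ → Set) : ℕ → ℕ → List ℕ → Set where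
  rows : (A B C : List ℕ) → All P A → All P B → All P C → Rows P (length A) (length B) (A ++ B ++ C)

splitRows : {P : ℕ → Set} (a b : ℕ) (q : List ℕ) → a + b ≤ length q → All P q → Rows P a b q
splitRows a b q le pq with splitAt a q (≤-trans (m≤m+n a b) le) pq
... | split A R pA pR with splitAt b R (+-cancelˡ-≤ (length A) b (length R) (subst (length A + b ≤_) (length-++ A) le)) pR
...   | split B C pB pC = rows A B C pA pB pC

-- Removing the largest entry

validRows-∷ʳ-row₁ : ∀ x S (A B C : List ℕ) → All (_< x) A → All (_< x) B →
  validRows S (A ++ x ∷ []) B C ≡ (length B ≤ᵇ length A) ∧ validRows S A B C
validRows-∷ʳ-row₁ x S A B C pA pB with length B ≤ᵇ length A in fits
... | true rewrite increasing-∷ʳ x A pA | columns12-∷ʳˡ x A B (≤ᵇ⇒≤ (length B) (length A) (Equivalence.from T-≡ fits)) = refl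
... | false rewrite columns12-∷ʳˡ-max x A B pB (≰⇒> (λ le → subst T fits (≤⇒≤ᵇ le)))
                  | ∧-zeroʳ (increasing B) = ∧-zeroʳ (increasing (A ++ x ∷ []))

validRows-∷ʳ-row₂ : ∀ x s S (A B C : List ℕ) → All (_< x) A → All (_< x) B → All (_< x) C → length S ≡ length B →
  validRows (S ++ s ∷ []) A (B ++ x ∷ []) C ≡ not s ∧ validRows S A B C
validRows-∷ʳ-row₂ x false S A B C pA pB pC eS
  rewrite increasing-∷ʳ x B pB | columns12-∷ʳʳ x A B pA | columns23-∷ʳ-false x S B C eS = refl
validRows-∷ʳ-row₂ x true S A B C pA pB pC eS
  rewrite increasing-∷ʳ x B pB | columns12-∷ʳʳ x A B pA | columns23-∷ʳ-true-max x S B C pC eS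
        | ∧-zeroʳ (columns12 A B) | ∧-zeroʳ (increasing B) = ∧-zeroʳ (increasing A)

-- Inside an increasing row, the largest entry can only be the last one.
∑-insertAt-last : ∀ x (P : List ℕ) (f : List ℕ → Bool) → All (_< x) P →
  (∀ R → increasing R ≡ false → f R ≡ false) →
  ∑[ j < suc (length P) ] 𝟙 (f (insertAt j x P)) ≡ 𝟙 (f (P ++ x ∷ []))
∑-insertAt-last x P f pP needsIncreasing = begin
  ∑< (suc (length P)) h          ≡⟨ ∑<-suc (length P) h ⟩
  ∑< (length P) h + h (length P) ≡⟨ cong₂ _+_ earlier (cong (𝟙 ∘ f) (insertAt-length x P)) ⟩
  𝟙 (f (P ++ x ∷ [])) ∎
  where
  open ≡-Reasoning
  h : ℕ → ℕ
  h j = 𝟙 (f (insertAt j x P))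
  earlier : ∑< (length P) h ≡ 0
  earlier = trans (∑<-cong (length P) (λ j lt → cong 𝟙 (needsIncreasing _ (increasing-insertAt-max x j P pP lt))))
                  (∑<-0 (length P))

maxInRow₁ : ∀ x S {n m q} → Rows (_< x) n m q →
  ∑[ j < suc n ] 𝟙 (validFilling (suc n) m S (insertAt j x q)) ≡ onlyIf (m ≤ᵇ n) (𝟙 (validFilling n m S q))
maxInRow₁ x S (rows A B C pA pB pC) = begin
  ∑[ j < suc (length A) ] 𝟙 (validFilling (suc (length A)) (length B) S (insertAt j x (A ++ B ++ C)))
    ≡⟨ ∑<-cong (suc (length A)) (λ j lt → cong 𝟙 (trans
         (cong (validFilling (suc (length A)) (length B) S) (insertAt-++ˡ j x A (B ++ C) (<⇒≤pred lt)))
         (validFilling-++ S (insertAt j x A) B C (length-insertAt j x A) refl))) ⟩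
  ∑[ j < suc (length A) ] 𝟙 (validRows S (insertAt j x A) B C)
    ≡⟨ ∑-insertAt-last x A (λ R → validRows S R B C) pA (λ R → validRows-row₁-increasing S R B C) ⟩
  𝟙 (validRows S (A ++ x ∷ []) B C)
    ≡⟨ trans (cong 𝟙 (validRows-∷ʳ-row₁ x S A B C pA pB)) (𝟙-∧ (length B ≤ᵇ length A) _) ⟩
  onlyIf (length B ≤ᵇ length A) (𝟙 (validRows S A B C))
    ≡⟨ cong (onlyIf (length B ≤ᵇ length A) ∘ 𝟙) (validFilling-++ S A B C refl refl) ⟨
  onlyIf (length B ≤ᵇ length A) (𝟙 (validFilling (length A) (length B) S (A ++ B ++ C))) ∎
  where open ≡-Reasoning

maxInRow₂ : ∀ x s S {n m q} → Rows (_< x) n m q → length S ≡ m →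
  ∑[ i < suc m ] 𝟙 (validFilling n (suc m) (S ++ s ∷ []) (insertAt (n + i) x q))
    ≡ onlyIf (not s) (𝟙 (validFilling n m S q))
maxInRow₂ x s S (rows A B C pA pB pC) eS = begin
  ∑[ i < suc (length B) ] 𝟙 (validFilling (length A) (suc (length B)) S' (insertAt (length A + i) x (A ++ B ++ C)))
    ≡⟨ ∑<-cong (suc (length B)) (λ i lt → cong 𝟙 (trans
         (cong (validFilling (length A) (suc (length B)) S')
               (trans (insertAt-++ʳ i x A (B ++ C)) (cong (A ++_) (insertAt-++ˡ i x B C (<⇒≤pred lt)))))
         (validFilling-++ S' A (insertAt i x B) C refl (length-insertAt i x B)))) ⟩
  ∑[ i < suc (length B) ] 𝟙 (validRows S' A (insertAt i x B) C)
    ≡⟨ ∑-insertAt-last x B (λ R → validRows S' A R C) pB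
         (λ R → validRows-row₂-increasing S' A R C) ⟩
  𝟙 (validRows S' A (B ++ x ∷ []) C)
    ≡⟨ trans (cong 𝟙 (validRows-∷ʳ-row₂ x s S A B C pA pB pC eS)) (𝟙-∧ (not s) _) ⟩
  onlyIf (not s) (𝟙 (validRows S A B C))
    ≡⟨ cong (onlyIf (not s) ∘ 𝟙) (validFilling-++ S A B C refl refl) ⟨
  onlyIf (not s) (𝟙 (validFilling (length A) (length B) S (A ++ B ++ C))) ∎
  where
  open ≡-Reasoning
  S' = S ++ s ∷ []

maxInRow₃ : ∀ x S t {n m q} → Rows (_< x) n m q → t < card S →
  validFilling n m S (insertAt (n + m + t) x q) ≡ validFilling n m (removeNth t S) q
maxInRow₃ x S t (rows A B C pA pB pC) lt = begin
  validFilling (length A) (length B) S (insertAt (length A + length B + t) x (A ++ B ++ C))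
    ≡⟨ cong (λ z → validFilling (length A) (length B) S (insertAt z x (A ++ B ++ C))) (+-assoc (length A) (length B) t) ⟩
  validFilling (length A) (length B) S (insertAt (length A + (length B + t)) x (A ++ B ++ C))
    ≡⟨ cong (validFilling (length A) (length B) S) (trans (insertAt-++ʳ (length B + t) x A (B ++ C)) (cong (A ++_) (insertAt-++ʳ t x B C))) ⟩
  validFilling (length A) (length B) S (A ++ B ++ insertAt t x C)
    ≡⟨ validFilling-++ S A B (insertAt t x C) refl refl ⟩
  validRows S A B (insertAt t x C)
    ≡⟨ cong (λ z → increasing A ∧ (increasing B ∧ (columns12 A B ∧ z))) (columns23-insertAt-max x t S B C pB lt) ⟩
  validRows (removeNth t S) A B C
    ≡⟨ validFilling-++ (removeNth t S) A B C refl refl ⟨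
  validFilling (length A) (length B) (removeNth t S) (A ++ B ++ C) ∎
  where open ≡-Reasoning

perms-labels : ∀ N → All (λ q → All (_< suc N) q × length q ≡ N) (perms (labels N))
perms-labels N = All.map (λ (pq , lq) → pq , trans lq (length-labels N)) (All-perms (labels N) (All-labels-< N))

fillings-as-∑ : ∀ {N} n m S → n + m + card S ≡ N →
  fillings n m S ≡ ∑[ p ∈ perms (labels N) ] 𝟙 (validFilling n m S p)
fillings-as-∑ n m S refl = length-filterᵇ (validFilling n m S) (perms (labels (n + m + card S)))

-- Valid fillings of shape (suc n, m, S) whose largest entry is the j-th letter (from 0) of the reading word.
withMaxAt : ℕ → ℕ → List Bool → ℕ → ℕ
withMaxAt n m S j = ∑[ q ∈ perms (labels N) ] 𝟙 (validFilling (suc n) m S (insertAt j (suc N) q))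
  where N = n + m + card S

fillings-byMaxPosition : ∀ n m S → fillings (suc n) m S ≡ ∑[ j < suc n + m + card S ] withMaxAt n m S j
fillings-byMaxPosition n m S = begin
  fillings (suc n) m S
    ≡⟨ fillings-as-∑ (suc n) m S refl ⟩
  ∑ (perms (labels (suc N))) valid
    ≡⟨ cong (λ L → ∑ (perms L) valid) (labels-suc N) ⟩
  ∑ (perms (labels N ++ suc N ∷ [])) valid
    ≡⟨ ∑-perms-∷ʳ (labels N) (suc N) valid ⟩
  ∑[ q ∈ perms (labels N) ] ∑ (insertions (suc N) q) valid
    ≡⟨ ∑-congᴬ (perms (labels N)) (perms-labels N) (λ q (_ , lq) →
         trans (∑-insertions (suc N) q valid) (cong (λ l → ∑< (suc l) (λ j → valid (insertAt j (suc N) q))) lq)) ⟩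
  ∑[ q ∈ perms (labels N) ] ∑[ j < suc N ] valid (insertAt j (suc N) q)
    ≡⟨ ∑-∑<-comm (perms (labels N)) (suc N) (λ q j → valid (insertAt j (suc N) q)) ⟩
  ∑[ j < suc N ] withMaxAt n m S j ∎
  where
  open ≡-Reasoning
  N = n + m + card S
  valid : List ℕ → ℕ
  valid p = 𝟙 (validFilling (suc n) m S p)

withMaxInRow₁ : ∀ n m S → ∑[ j < suc n ] withMaxAt n m S j ≡ onlyIf (m ≤ᵇ n) (fillings n m S)
withMaxInRow₁ n m S = begin
  ∑[ j < suc n ] withMaxAt n m S j
    ≡⟨ ∑-∑<-comm (perms (labels N)) (suc n) (λ q j → 𝟙 (validFilling (suc n) m S (insertAt j (suc N) q))) ⟨
  ∑[ q ∈ perms (labels N) ] ∑[ j < suc n ] 𝟙 (validFilling (suc n) m S (insertAt j (suc N) q))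
    ≡⟨ ∑-congᴬ (perms (labels N)) (perms-labels N) (λ q (pq , lq) →
         maxInRow₁ (suc N) S (splitRows n m q (subst (n + m ≤_) (sym lq) (m≤m+n (n + m) (card S))) pq)) ⟩
  ∑[ q ∈ perms (labels N) ] onlyIf (m ≤ᵇ n) (𝟙 (validFilling n m S q))
    ≡⟨ ∑-onlyIf (perms (labels N)) (m ≤ᵇ n) (𝟙 ∘ validFilling n m S) ⟩
  onlyIf (m ≤ᵇ n) (∑[ q ∈ perms (labels N) ] 𝟙 (validFilling n m S q))
    ≡⟨ cong (onlyIf (m ≤ᵇ n)) (fillings-as-∑ n m S refl) ⟨
  onlyIf (m ≤ᵇ n) (fillings n m S) ∎
  where
  open ≡-Reasoning
  N = n + m + card S

withMaxInRow₂ : ∀ n m s S → length S ≡ m →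
  ∑[ i < suc m ] withMaxAt n (suc m) (S ++ s ∷ []) (suc n + i) ≡ onlyIf (not s) (fillings (suc n) m S)
withMaxInRow₂ n m s S eS = begin
  ∑[ i < suc m ] withMaxAt n (suc m) S' (suc n + i)
    ≡⟨ ∑-∑<-comm (perms (labels N)) (suc m) (λ q i → 𝟙 (validFilling (suc n) (suc m) S' (insertAt (suc n + i) (suc N) q))) ⟨
  ∑[ q ∈ perms (labels N) ] ∑[ i < suc m ] 𝟙 (validFilling (suc n) (suc m) S' (insertAt (suc n + i) (suc N) q))
    ≡⟨ ∑-congᴬ (perms (labels N)) (perms-labels N) (λ q (pq , lq) →
         maxInRow₂ (suc N) s S (splitRows (suc n) m q (subst (_≤ length q) (+-suc n m) (fits q lq)) pq) eS) ⟩
  ∑[ q ∈ perms (labels N) ] onlyIf (not s) (𝟙 (validFilling (suc n) m S q))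
    ≡⟨ ∑-onlyIf (perms (labels N)) (not s) (𝟙 ∘ validFilling (suc n) m S) ⟩
  onlyIf (not s) (∑[ q ∈ perms (labels N) ] 𝟙 (validFilling (suc n) m S q))
    ≡⟨ lastColumn s ⟨
  onlyIf (not s) (fillings (suc n) m S) ∎
  where
  open ≡-Reasoning
  S' = S ++ s ∷ []
  N = n + suc m + card S'
  fits : ∀ q → length q ≡ N → n + suc m ≤ length q
  fits q lq = subst (n + suc m ≤_) (sym lq) (m≤m+n (n + suc m) (card S'))
  lastColumn : ∀ s → onlyIf (not s) (fillings (suc n) m S)
    ≡ onlyIf (not s) (∑[ q ∈ perms (labels (n + suc m + card (S ++ s ∷ []))) ] 𝟙 (validFilling (suc n) m S q))
  lastColumn true = refl
  lastColumn false = fillings-as-∑ (suc n) m S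
    (trans (cong (_+ card S) (sym (+-suc n m))) (cong (n + suc m +_) (sym (card-∷ʳ-false S))))

withMaxInRow₃ : ∀ n m S t → t < card S → withMaxAt n m S (suc n + m + t) ≡ fillings (suc n) m (removeNth t S)
withMaxInRow₃ n m S t lt = begin
  withMaxAt n m S (suc n + m + t)
    ≡⟨ ∑-congᴬ (perms (labels N)) (perms-labels N) (λ q (pq , lq) →
         cong 𝟙 (maxInRow₃ (suc N) S t (splitRows (suc n) m q (subst (suc n + m ≤_) (sym (trans lq size)) (m≤m+n (suc n + m) _)) pq) lt)) ⟩
  ∑[ q ∈ perms (labels N) ] 𝟙 (validFilling (suc n) m (removeNth t S) q)
    ≡⟨ fillings-as-∑ (suc n) m (removeNth t S) (sym size) ⟨
  fillings (suc n) m (removeNth t S) ∎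
  where
  open ≡-Reasoning
  N = n + m + card S
  size : N ≡ suc n + m + card (removeNth t S)
  size = trans (cong (n + m +_) (sym (card-removeNth t S lt))) (+-suc (n + m) (card (removeNth t S)))

fillings-suc : ∀ n m S → fillings (suc n) m S ≡
  onlyIf (m ≤ᵇ n) (fillings n m S) + ∑[ i < m ] withMaxAt n m S (suc n + i) + ∑[ t < card S ] fillings (suc n) m (removeNth t S)
fillings-suc n m S = begin
  fillings (suc n) m S
    ≡⟨ fillings-byMaxPosition n m S ⟩
  ∑< (suc n + m + card S) h
    ≡⟨ ∑<-+ (suc n + m) (card S) h ⟩
  ∑< (suc n + m) h + ∑[ t < card S ] h (suc n + m + t)
    ≡⟨ cong₂ _+_ (∑<-+ (suc n) m h) (∑<-cong (card S) (withMaxInRow₃ n m S)) ⟩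
  ∑< (suc n) h + ∑[ i < m ] h (suc n + i) + ∑[ t < card S ] fillings (suc n) m (removeNth t S)
    ≡⟨ cong (λ z → z + ∑[ i < m ] h (suc n + i) + ∑[ t < card S ] fillings (suc n) m (removeNth t S)) (withMaxInRow₁ n m S) ⟩
  onlyIf (m ≤ᵇ n) (fillings n m S) + ∑[ i < m ] h (suc n + i) + ∑[ t < card S ] fillings (suc n) m (removeNth t S) ∎
  where
  open ≡-Reasoning
  h = withMaxAt n m S

-- Sums over k-subsets

subsetSum : ℕ → ℕ → (List Bool → ℕ) → ℕ
subsetSum m k f = ∑[ S ∈ subsets m ] onlyIf (card S ≡ᵇ k) (f S)

All-subsets-length : ∀ m → All (λ S → length S ≡ m) (subsets m)
All-subsets-length zero = refl ∷ []
All-subsets-length (suc m) = All-concatMap (λ s → (true ∷ s) ∷ (false ∷ s) ∷ []) (subsets m)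
  (All.map (λ l → cong suc l ∷ cong suc l ∷ []) (All-subsets-length m))

∑-subsets-suc : ∀ m (Φ : List Bool → ℕ) →
  ∑ (subsets (suc m)) Φ ≡ ∑[ S ∈ subsets m ] (Φ (true ∷ S) + Φ (false ∷ S))
∑-subsets-suc m Φ = trans (∑-concatMap (λ s → (true ∷ s) ∷ (false ∷ s) ∷ []) (subsets m) Φ)
  (∑-cong (subsets m) (λ S → cong (Φ (true ∷ S) +_) (+-identityʳ _)))

∑-subsets-∷ʳ : ∀ m (Φ : List Bool → ℕ) →
  ∑ (subsets (suc m)) Φ ≡ ∑[ S ∈ subsets m ] (Φ (S ++ true ∷ []) + Φ (S ++ false ∷ []))
∑-subsets-∷ʳ zero Φ = sym (+-assoc (Φ (true ∷ [])) (Φ (false ∷ [])) 0)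
∑-subsets-∷ʳ (suc m) Φ = begin
  ∑ (subsets (suc (suc m))) Φ
    ≡⟨ ∑-subsets-suc (suc m) Φ ⟩
  ∑[ S ∈ subsets (suc m) ] (Φ (true ∷ S) + Φ (false ∷ S))
    ≡⟨ ∑-subsets-∷ʳ m (λ S → Φ (true ∷ S) + Φ (false ∷ S)) ⟩
  ∑[ S ∈ subsets m ] (Φ′ true true S + Φ′ false true S + (Φ′ true false S + Φ′ false false S))
    ≡⟨ ∑-cong (subsets m) (λ S → interchange (Φ′ true true S) (Φ′ false true S) (Φ′ true false S) (Φ′ false false S)) ⟩
  ∑[ S ∈ subsets m ] (Φ′ true true S + Φ′ true false S + (Φ′ false true S + Φ′ false false S))
    ≡⟨ ∑-subsets-suc m (λ S → Φ (S ++ true ∷ []) + Φ (S ++ false ∷ [])) ⟨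
  ∑[ S ∈ subsets (suc m) ] (Φ (S ++ true ∷ []) + Φ (S ++ false ∷ [])) ∎
  where
  open ≡-Reasoning
  Φ′ : Bool → Bool → List Bool → ℕ
  Φ′ first last S = Φ (first ∷ S ++ last ∷ [])
  interchange : ∀ a b c d → a + b + (c + d) ≡ a + c + (b + d)
  interchange = solve-∀

subsetSum-+ : ∀ m k (f g : List Bool → ℕ) → subsetSum m k (λ S → f S + g S) ≡ subsetSum m k f + subsetSum m k g
subsetSum-+ m k f g = trans (∑-cong (subsets m) (λ S → onlyIf-+ (card S ≡ᵇ k) (f S) (g S))) (∑-+ (subsets m) _ _)

subsetSum-0 : ∀ m k → subsetSum m k (λ _ → 0) ≡ 0
subsetSum-0 m k = trans (∑-cong (subsets m) (λ S → onlyIf-0 (card S ≡ᵇ k))) (∑-0 (subsets m))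

subsetSum-suc-zero : ∀ m f → subsetSum (suc m) 0 f ≡ subsetSum m 0 (f ∘ (false ∷_))
subsetSum-suc-zero m f = ∑-subsets-suc m _

subsetSum-suc-suc : ∀ m k f →
  subsetSum (suc m) (suc k) f ≡ subsetSum m k (f ∘ (true ∷_)) + subsetSum m (suc k) (f ∘ (false ∷_))
subsetSum-suc-suc m k f = trans (∑-subsets-suc m _) (∑-+ (subsets m) _ _)

subsetSum-> : ∀ m k f → m < k → subsetSum m k f ≡ 0
subsetSum-> zero (suc k) f _ = refl
subsetSum-> (suc m) (suc k) f (s≤s m<k) = trans (subsetSum-suc-suc m k f)
  (cong₂ _+_ (subsetSum-> m k (f ∘ (true ∷_)) m<k) (subsetSum-> m (suc k) (f ∘ (false ∷_)) (m<n⇒m<1+n m<k)))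

subsetSum-removeNth-zero : ∀ m (f : List Bool → ℕ) → subsetSum m 0 (λ S → ∑[ t < card S ] f (removeNth t S)) ≡ 0
subsetSum-removeNth-zero m f = trans (∑-cong (subsets m) emptyOrSkipped) (∑-0 (subsets m))
  where
  emptyOrSkipped : ∀ S → onlyIf (card S ≡ᵇ 0) (∑[ t < card S ] f (removeNth t S)) ≡ 0
  emptyOrSkipped S with card S
  ... | zero = refl
  ... | suc _ = refl

count-regroup : ∀ m i a c → (m ≤ i → a ≡ 0) → a + (m ∸ i) * c + (m ∸ suc i) * a ≡ (m ∸ i) * (c + a)
count-regroup m i a c vanishes with i <? m
... | yes i<m rewrite +-∸-assoc 1 i<m = shuffle a c (m ∸ suc i)
  where
  shuffle : ∀ a c d → a + suc d * c + d * a ≡ suc d * (c + a)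
  shuffle = solve-∀
... | no i≮m rewrite vanishes (≮⇒≥ i≮m) | m≤n⇒m∸n≡0 (m≤n⇒m≤1+n (≮⇒≥ i≮m)) =
  trans (+-identityʳ _) (cong ((m ∸ i) *_) (sym (+-identityʳ c)))

-- Each j-subset T ⊆ {1..m} is S minus one element for exactly m - j subsets S ⊇ T of size j + 1.
subsetSum-removeNth : ∀ m j (f : List Bool → ℕ) →
  subsetSum m (suc j) (λ S → ∑[ t < card S ] f (removeNth t S)) ≡ (m ∸ j) * subsetSum m j f
subsetSum-removeNth zero j f = cong (_* (onlyIf (0 ≡ᵇ j) (f []) + 0)) (sym (0∸n≡0 j))
subsetSum-removeNth (suc m) zero f = begin
  subsetSum (suc m) 1 R
    ≡⟨ subsetSum-suc-suc m 0 R ⟩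
  subsetSum m 0 (R ∘ (true ∷_)) + subsetSum m 1 (R ∘ (false ∷_))
    ≡⟨ cong₂ _+_ (subsetSum-+ m 0 (f ∘ (false ∷_)) _) (subsetSum-removeNth m 0 (f ∘ (false ∷_))) ⟩
  a + subsetSum m 0 (λ S → ∑[ t < card S ] f (true ∷ removeNth t S)) + m * a
    ≡⟨ cong (λ z → a + z + m * a) (subsetSum-removeNth-zero m (f ∘ (true ∷_))) ⟩
  a + 0 + m * a
    ≡⟨ collect a m ⟩
  suc m * a
    ≡⟨ cong (suc m *_) (subsetSum-suc-zero m f) ⟨
  suc m * subsetSum (suc m) 0 f ∎
  where
  open ≡-Reasoning
  R = λ S → ∑[ t < card S ] f (removeNth t S)
  a = subsetSum m 0 (f ∘ (false ∷_))
  collect : ∀ a m → a + 0 + m * a ≡ suc m * a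
  collect = solve-∀
subsetSum-removeNth (suc m) (suc i) f = begin
  subsetSum (suc m) (suc (suc i)) R
    ≡⟨ subsetSum-suc-suc m (suc i) R ⟩
  subsetSum m (suc i) (R ∘ (true ∷_)) + subsetSum m (suc (suc i)) (R ∘ (false ∷_))
    ≡⟨ cong₂ _+_ (subsetSum-+ m (suc i) (f ∘ (false ∷_)) _) (subsetSum-removeNth m (suc i) (f ∘ (false ∷_))) ⟩
  a + subsetSum m (suc i) (λ S → ∑[ t < card S ] f (true ∷ removeNth t S)) + (m ∸ suc i) * a
    ≡⟨ cong (λ z → a + z + (m ∸ suc i) * a) (subsetSum-removeNth m i (f ∘ (true ∷_))) ⟩
  a + (m ∸ i) * a′ + (m ∸ suc i) * a
    ≡⟨ count-regroup m i a a′ (λ m≤i → subsetSum-> m (suc i) (f ∘ (false ∷_)) (s≤s m≤i)) ⟩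
  (m ∸ i) * (a′ + a)
    ≡⟨ cong ((m ∸ i) *_) (subsetSum-suc-suc m i f) ⟨
  (m ∸ i) * subsetSum (suc m) (suc i) f ∎
  where
  open ≡-Reasoning
  R = λ S → ∑[ t < card S ] f (removeNth t S)
  a = subsetSum m (suc i) (f ∘ (false ∷_))
  a′ = subsetSum m i (f ∘ (true ∷_))

subsetSum-cong : ∀ m k {f g : List Bool → ℕ} → (∀ S → f S ≡ g S) → subsetSum m k f ≡ subsetSum m k g
subsetSum-cong m k e = ∑-cong (subsets m) (λ S → cong (onlyIf (card S ≡ᵇ k)) (e S))

-- The recurrence for b and its uniqueness

b-subsetSum : ∀ n m k → m ≤ n → b n m k ≡ subsetSum m k (fillings n m)
b-subsetSum n m k m≤n with m ≤ᵇ n | ≤⇒≤ᵇ m≤n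
... | true | _ = trans (sum-map (filterᵇ (λ S → card S ≡ᵇ k) (subsets m)) (fillings n m))
                        (∑-filterᵇ (λ S → card S ≡ᵇ k) (subsets m) (fillings n m))

subsetSum-withMaxInRow₁ : ∀ n m k → subsetSum m k (λ S → onlyIf (m ≤ᵇ n) (fillings n m S)) ≡ termN b (suc n) m k
subsetSum-withMaxInRow₁ n m k = byFit (m ≤ᵇ n) (≤ᵇ⇒≤ m n)
  where
  byFit : ∀ c → (T c → m ≤ n) → subsetSum m k (λ S → onlyIf c (fillings n m S)) ≡ onlyIf c (b n m k)
  byFit true fits = sym (b-subsetSum n m k (fits tt))
  byFit false _ = subsetSum-0 m k

subsetSum-withMaxInRow₂ : ∀ n m k → m ≤ suc n →
  subsetSum m k (λ S → ∑[ i < m ] withMaxAt n m S (suc n + i)) ≡ termM b (suc n) m k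
subsetSum-withMaxInRow₂ n zero k _ = subsetSum-0 0 k
subsetSum-withMaxInRow₂ n (suc m) k m≤n = begin
  subsetSum (suc m) k W
    ≡⟨ ∑-subsets-∷ʳ m (λ S → onlyIf (card S ≡ᵇ k) (W S)) ⟩
  ∑[ S ∈ subsets m ] (onlyIf (card (S ++ true ∷ []) ≡ᵇ k) (W (S ++ true ∷ []))
                       + onlyIf (card (S ++ false ∷ []) ≡ᵇ k) (W (S ++ false ∷ [])))
    ≡⟨ ∑-congᴬ (subsets m) (All-subsets-length m) (λ S lS → cong₂ _+_
         (trans (cong (onlyIf _) (withMaxInRow₂ n m true S lS)) (onlyIf-0 _))
         (cong₂ onlyIf (cong (_≡ᵇ k) (card-∷ʳ-false S)) (withMaxInRow₂ n m false S lS))) ⟩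
  subsetSum m k (fillings (suc n) m)
    ≡⟨ lastTerm ⟩
  termM b (suc n) (suc m) k ∎
  where
  open ≡-Reasoning
  W = λ S → ∑[ i < suc m ] withMaxAt n (suc m) S (suc n + i)
  lastTerm : subsetSum m k (fillings (suc n) m) ≡ onlyIf (k ≤ᵇ m) (b (suc n) m k)
  lastTerm with k ≤ᵇ m in fits
  ... | true = sym (b-subsetSum (suc n) m k (≤-trans (n≤1+n m) m≤n))
  ... | false = subsetSum-> m k (fillings (suc n) m) (≰⇒> (λ k≤m → subst T fits (≤⇒≤ᵇ k≤m)))

subsetSum-withMaxInRow₃ : ∀ n m k → k ≤ m → m ≤ suc n →
  subsetSum m k (λ S → ∑[ t < card S ] fillings (suc n) m (removeNth t S)) ≡ (m ∸ k + 1) * termK b (suc n) m k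
subsetSum-withMaxInRow₃ n m zero _ _ = trans (subsetSum-removeNth-zero m (fillings (suc n) m)) (sym (*-zeroʳ (m + 1)))
subsetSum-withMaxInRow₃ n m (suc j) j<m m≤n = trans (subsetSum-removeNth m j (fillings (suc n) m))
  (cong₂ _*_ (trans (+-∸-assoc 1 j<m) (+-comm 1 (m ∸ suc j))) (sym (b-subsetSum (suc n) m j m≤n)))

b-recurrence : Recurrence b
b-recurrence (suc n) m k _ k≤m m≤n = begin
  b (suc n) m k
    ≡⟨ b-subsetSum (suc n) m k m≤n ⟩
  subsetSum m k (fillings (suc n) m)
    ≡⟨ subsetSum-cong m k (fillings-suc n m) ⟩
  subsetSum m k (λ S → row₁ S + row₂ S + row₃ S)
    ≡⟨ trans (subsetSum-+ m k (λ S → row₁ S + row₂ S) row₃) (cong (_+ subsetSum m k row₃) (subsetSum-+ m k row₁ row₂)) ⟩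
  subsetSum m k row₁ + subsetSum m k row₂ + subsetSum m k row₃
    ≡⟨ cong₂ _+_ (cong₂ _+_ (subsetSum-withMaxInRow₁ n m k) (subsetSum-withMaxInRow₂ n m k m≤n))
                 (subsetSum-withMaxInRow₃ n m k k≤m m≤n) ⟩
  termN b (suc n) m k + termM b (suc n) m k + (m ∸ k + 1) * termK b (suc n) m k
    ≡⟨ reverse (termN b (suc n) m k) (termM b (suc n) m k) ((m ∸ k + 1) * termK b (suc n) m k) ⟩
  (m ∸ k + 1) * termK b (suc n) m k + termM b (suc n) m k + termN b (suc n) m k ∎
  where
  open ≡-Reasoning
  row₁ row₂ row₃ : List Bool → ℕ
  row₁ S = onlyIf (m ≤ᵇ n) (fillings n m S)
  row₂ S = ∑[ i < m ] withMaxAt n m S (suc n + i)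
  row₃ S = ∑[ t < card S ] fillings (suc n) m (removeNth t S)
  reverse : ∀ x y z → x + y + z ≡ z + y + x
  reverse = solve-∀

b-initialValues : InitialValues b
b-initialValues = refl , refl , refl , refl

module _ {f g : ℕ → ℕ → ℕ → ℕ} (rec-f : Recurrence f) (rec-g : Recurrence g) where

  AgreeAt : ℕ → Set
  AgreeAt n = ∀ m k → k ≤ m → m ≤ n → f n m k ≡ g n m k

  agree-by-terms : ∀ n → AgreeAt (suc n) → ∀ m k → k ≤ m → m ≤ suc (suc n) →
    termK f (suc (suc n)) m k ≡ termK g (suc (suc n)) m k → termM f (suc (suc n)) m k ≡ termM g (suc (suc n)) m k →
    f (suc (suc n)) m k ≡ g (suc (suc n)) m k
  agree-by-terms n IH m k k≤m m≤n sameK sameM = begin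
    f (suc (suc n)) m k
      ≡⟨ rec-f (suc (suc n)) m k (s≤s (s≤s z≤n)) k≤m m≤n ⟩
    (m ∸ k + 1) * termK f (suc (suc n)) m k + termM f (suc (suc n)) m k + termN f (suc (suc n)) m k
      ≡⟨ cong₂ _+_ (cong₂ _+_ (cong ((m ∸ k + 1) *_) sameK) sameM)
                   (onlyIf-cong (m ≤ᵇ suc n) (λ fits → IH m k k≤m (≤ᵇ⇒≤ m (suc n) fits))) ⟩
    (m ∸ k + 1) * termK g (suc (suc n)) m k + termM g (suc (suc n)) m k + termN g (suc (suc n)) m k
      ≡⟨ rec-g (suc (suc n)) m k (s≤s (s≤s z≤n)) k≤m m≤n ⟨
    g (suc (suc n)) m k ∎
    where open ≡-Reasoning

  -- Lexicographic induction on (m, k): termK lowers k, termM lowers m.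
  agree-step : ∀ n → AgreeAt (suc n) → AgreeAt (suc (suc n))
  agree-step n IH zero zero k≤m m≤n = agree-by-terms n IH zero zero k≤m m≤n refl refl
  agree-step n IH (suc m) zero k≤m m≤n = agree-by-terms n IH (suc m) zero k≤m m≤n refl
    (onlyIf-cong (0 ≤ᵇ m) (λ _ → agree-step n IH m zero z≤n (≤-trans (n≤1+n m) m≤n)))
  agree-step n IH (suc m) (suc k) k≤m m≤n = agree-by-terms n IH (suc m) (suc k) k≤m m≤n
    (agree-step n IH (suc m) k (≤-trans (n≤1+n k) k≤m) m≤n)
    (onlyIf-cong (suc k ≤ᵇ m) (λ fits → agree-step n IH m (suc k) (≤ᵇ⇒≤ (suc k) m fits) (≤-trans (n≤1+n m) m≤n)))

  recurrence-unique : InitialValues f → InitialValues g → ∀ n → AgreeAt n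
  recurrence-unique (f000 , _ , _ , _) (g000 , _ , _ , _) zero zero zero _ _ = trans f000 (sym g000)
  recurrence-unique (_ , f100 , _ , _) (_ , g100 , _ , _) (suc zero) zero zero _ _ = trans f100 (sym g100)
  recurrence-unique (_ , _ , f110 , _) (_ , _ , g110 , _) (suc zero) (suc zero) zero _ _ = trans f110 (sym g110)
  recurrence-unique (_ , _ , _ , f111) (_ , _ , _ , g111) (suc zero) (suc zero) (suc zero) _ _ = trans f111 (sym g111)
  recurrence-unique _ _ (suc zero) (suc zero) (suc (suc k)) (s≤s ()) _
  recurrence-unique _ _ (suc zero) (suc (suc m)) k _ (s≤s ())
  recurrence-unique init-f init-g (suc (suc n)) = agree-step n (recurrence-unique init-f init-g (suc n))

proposition2p5 : Recurrence b × InitialValues b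
    × ((f : ℕ → ℕ → ℕ → ℕ) → Recurrence f → InitialValues f →
       ∀ n m k → k ≤ m → m ≤ n → f n m k ≡ b n m k)
proposition2p5 = b-recurrence , b-initialValues ,
  λ f rec-f init-f → recurrence-unique rec-f b-recurrence init-f b-initialValues
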